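{- Let $\overline{\mathcal{L}}$ be the set of overpartitions in which the last occurrence of a number may be overlined and no two adjacent parts are both overlined. Then $\overline{\mathcal{L}}$ is a separable overpartition class.
   Context: An overpartition (in the "last occurrence" convention) is a partition in which the last occurrence of a number may be overlined; parts are listed in non-increasing order of size, with $\overline{t}$ listed after the non-overlined copies of $t$. Adjacency refers to positions in this list. For a positive integer $t$ and nonnegative integer $d$, $\overline{t}+d=\overline{t+d}$. A separable overpartition class is a set $\mathcal{P}$ of overpartitions for which there is a subset $\mathcal{B}\subset\mathcal{P}$ (the basis) such that for each $m\geq 1$ the number of overpartitions in $\mathcal{B}$ with $m$ parts is finite, every overpartition in $\mathcal{P}$ with $m$ parts is uniquely of the form $(b_1+\pi_1,\ldots,b_m+\pi_m)$ with $(b_1,\ldots,b_m)\in\mathcal{B}$ and $(\pi_1,\ldots,\pi_m)$ a non-increasing sequence of nonnegative integers, and all overpartitions of this form lie in $\mathcal{P}$. -}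

module Defs where

open import Data.Nat using (ℕ; _+_; _≤_; _<_; _≥_)
open import Data.Bool using (Bool; true; false)
open import Data.Product using (_×_; _,_; Σ; ∃; proj₁; proj₂)
open import Data.Sum using (_⊎_)
open import Data.List using (List; []; _∷_; length; zipWith)
open import Data.List.Membership.Propositional using (_∈_)
open import Relation.Binary.PropositionalEquality using (_≡_)

Part : Set
Part = ℕ × Bool

size : Part → ℕ
size = proj₁

overlined : Part → Bool
overlined = proj₂

-- Two consecutive entries p , q of an overpartition listed in the
-- "last occurrence" convention: either the size strictly decreases,
-- or the sizes agree and the first one is not overlined
-- (so only the last copy of a number can be overlined, and t̄ comes
-- after the non-overlined copies of t).
AdjOK : Part → Part → Set
AdjOK p q = size q < size p ⊎ (size p ≡ size q × overlined p ≡ false)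

data Chain : List Part → Set where
  []  : Chain []
  [-] : ∀ p → Chain (p ∷ [])
  _∷_ : ∀ {p q xs} → AdjOK p q → Chain (q ∷ xs) → Chain (p ∷ q ∷ xs)

data AllPositive : List Part → Set where
  []  : AllPositive []
  _∷_ : ∀ {p xs} → 1 ≤ size p → AllPositive xs → AllPositive (p ∷ xs)

IsOverpartition : List Part → Set
IsOverpartition xs = AllPositive xs × Chain xs

data NoAdjOverlined : List Part → Set where
  []  : NoAdjOverlined []
  [-] : ∀ p → NoAdjOverlined (p ∷ [])
  _∷_ : ∀ {p q xs} → (overlined p ≡ true → overlined q ≡ false)
      → NoAdjOverlined (q ∷ xs) → NoAdjOverlined (p ∷ q ∷ xs)

Lbar : List Part → Set
Lbar xs = IsOverpartition xs × NoAdjOverlined xs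

data NonIncreasing : List ℕ → Set where
  []  : NonIncreasing []
  [-] : ∀ n → NonIncreasing (n ∷ [])
  _∷_ : ∀ {m n xs} → n ≤ m → NonIncreasing (n ∷ xs) → NonIncreasing (m ∷ n ∷ xs)

addPart : Part → ℕ → Part
addPart (t , b) d = (t + d , b)

-- (b₁+π₁, …, bₘ+πₘ)  (used only with length b ≡ length π)
_⊕_ : List Part → List ℕ → List Part
b ⊕ π = zipWith addPart b π

record Separable (P : List Part → Set) : Set₁ where
  field
    Basis        : List Part → Set
    basis⊆       : ∀ b → Basis b → P b
    basisFinite  : ∀ m → m ≥ 1 → Σ (List (List Part)) λ L →
                     ∀ b → Basis b → length b ≡ m → b ∈ L
    decompose    : ∀ x → P x → length x ≥ 1 →
                     Σ (List Part) λ b → Σ (List ℕ) λ π →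
                       Basis b × NonIncreasing π × length π ≡ length b × x ≡ b ⊕ π
    unique       : ∀ b b′ π π′ → Basis b → Basis b′ →
                     NonIncreasing π → NonIncreasing π′ →
                     length π ≡ length b → length π′ ≡ length b′ →
                     length b ≥ 1 →
                     b ⊕ π ≡ b′ ⊕ π′ → b ≡ b′ × π ≡ π′
    closed       : ∀ b π → Basis b → NonIncreasing π →
                     length π ≡ length b → P (b ⊕ π)

{-# OPTIONS --safe #-}
-- The overline pattern of an overpartition determines the least overpartition
-- with that pattern: reading from the end, the last part is 1 and every other
-- part exceeds the next one by 1 if it is overlined and equals it otherwise.
-- In any overpartition the drop from an overlined part to the next is ≥ 1 and
-- from a plain part ≥ 0, so subtracting the least overpartition with the same
-- pattern leaves a non-increasing sequence; conversely adding a non-increasing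
-- sequence keeps every adjacency valid and does not change the pattern.  The
-- condition defining L̄ only looks at the pattern, hence survives both ways.
module Submission where

open import Defs
open import Data.Nat using (ℕ; zero; suc; _+_; _∸_; _≤_; z≤n; s≤s)
open import Data.Nat.Properties
open import Data.Bool using (Bool; true; false)
open import Data.Product using (_×_; _,_; Σ; proj₁)
open import Data.Sum using (inj₁; inj₂)
open import Data.List using (List; []; _∷_; [_]; length; map; cartesianProductWith)
open import Data.List.Properties using (∷-injective; length-map)
open import Data.List.Membership.Propositional using (_∈_)
open import Data.List.Membership.Propositional.Properties using (∈-map⁺; ∈-cartesianProductWith⁺)
open import Data.List.Relation.Unary.Any using (here; there)
open import Function using (_∘′_)
open import Relation.Binary.PropositionalEquality
  using (_≡_; refl; sym; trans; cong; cong₂; subst; subst₂; module ≡-Reasoning)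

flags : List Part → List Bool
flags = map overlined

leastGap : Bool → ℕ
leastGap true  = 1
leastGap false = 0

leastSize : Bool → List Bool → ℕ
leastSize o []        = 1
leastSize o (o′ ∷ os) = leastGap o + leastSize o′ os

minimal : List Bool → List Part
minimal []       = []
minimal (o ∷ os) = (leastSize o os , o) ∷ minimal os

excess : List Part → List ℕ
excess []       = []
excess (p ∷ xs) = (size p ∸ leastSize (overlined p) (flags xs)) ∷ excess xs

flags-minimal : ∀ os → flags (minimal os) ≡ os
flags-minimal []       = refl
flags-minimal (o ∷ os) = cong (o ∷_) (flags-minimal os)

length-excess : ∀ xs → length (excess xs) ≡ length (minimal (flags xs))
length-excess []       = refl
length-excess (p ∷ xs) = cong suc (length-excess xs)

minimal-allPositive : ∀ os → AllPositive (minimal os)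
minimal-allPositive []            = []
minimal-allPositive (o ∷ [])      = s≤s z≤n ∷ []
minimal-allPositive (o ∷ o′ ∷ os) with minimal-allPositive (o′ ∷ os)
... | pos ∷ poss = ≤-trans pos (m≤n+m _ (leastGap o)) ∷ pos ∷ poss

minimal-chain : ∀ os → Chain (minimal os)
minimal-chain []                = []
minimal-chain (o ∷ [])          = [-] _
minimal-chain (true ∷ o′ ∷ os)  = inj₁ ≤-refl ∷ minimal-chain (o′ ∷ os)
minimal-chain (false ∷ o′ ∷ os) = inj₂ (refl , refl) ∷ minimal-chain (o′ ∷ os)

minimal-isOverpartition : ∀ os → IsOverpartition (minimal os)
minimal-isOverpartition os = minimal-allPositive os , minimal-chain os

AdjOK⇒leastGap+size≤size : ∀ p q → AdjOK p q → leastGap (overlined p) + size q ≤ size p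
AdjOK⇒leastGap+size≤size (_ , true)  _ (inj₁ q<p)        = q<p
AdjOK⇒leastGap+size≤size (_ , false) _ (inj₁ q<p)        = <⇒≤ q<p
AdjOK⇒leastGap+size≤size (_ , false) _ (inj₂ (p≡q , _)) = ≤-reflexive (sym p≡q)
AdjOK⇒leastGap+size≤size (_ , true)  _ (inj₂ (_ , ()))

leastSize≤size : ∀ {p xs} → IsOverpartition (p ∷ xs) → leastSize (overlined p) (flags xs) ≤ size p
leastSize≤size {p} {[]}    (pos ∷ _ , _)         = pos
leastSize≤size {p} {q ∷ _} (_ ∷ poss , adj ∷ ch) =
  ≤-trans (+-monoʳ-≤ (leastGap (overlined p)) (leastSize≤size (poss , ch)))
          (AdjOK⇒leastGap+size≤size p q adj)

excess-nonIncreasing : ∀ xs → IsOverpartition xs → NonIncreasing (excess xs)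
excess-nonIncreasing []           _                     = []
excess-nonIncreasing (p ∷ [])     _                     = [-] _
excess-nonIncreasing (p ∷ q ∷ xs) (_ ∷ poss , adj ∷ ch) =
  excess-q≤excess-p ∷ excess-nonIncreasing (q ∷ xs) (poss , ch)
  where
  g = leastGap (overlined p)
  s = leastSize (overlined q) (flags xs)
  excess-q≤excess-p : size q ∸ s ≤ size p ∸ (g + s)
  excess-q≤excess-p = begin
    size q ∸ s             ≡⟨ [m+n]∸[m+o]≡n∸o g (size q) s ⟨
    (g + size q) ∸ (g + s) ≤⟨ ∸-monoˡ-≤ (g + s) (AdjOK⇒leastGap+size≤size p q adj) ⟩
    size p ∸ (g + s)       ∎
    where open ≤-Reasoning

minimal⊕excess : ∀ xs → IsOverpartition xs → minimal (flags xs) ⊕ excess xs ≡ xs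
minimal⊕excess []       _                 = refl
minimal⊕excess (p ∷ xs) (pos ∷ poss , ch) =
  cong₂ _∷_ (cong (_, overlined p) (m+[n∸m]≡n (leastSize≤size (pos ∷ poss , ch))))
            (minimal⊕excess xs (poss , tail ch))
  where
  tail : ∀ {p xs} → Chain (p ∷ xs) → Chain xs
  tail ([-] _)  = []
  tail (_ ∷ ch) = ch

AdjOK-+ : ∀ p q {m n} → AdjOK p q → n ≤ m → AdjOK (addPart p m) (addPart q n)
AdjOK-+ _ _ (inj₁ q<p) n≤m = inj₁ (+-mono-<-≤ q<p n≤m)
AdjOK-+ _ _ (inj₂ (p≡q , plain)) n≤m with m≤n⇒m<n∨m≡n n≤m
... | inj₁ n<m = inj₁ (+-mono-≤-< (≤-reflexive (sym p≡q)) n<m)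
... | inj₂ n≡m = inj₂ (cong₂ _+_ p≡q (sym n≡m) , plain)

Chain-⊕ : ∀ {b π} → Chain b → NonIncreasing π → Chain (b ⊕ π)
Chain-⊕ {[]}        []         _           = []
Chain-⊕ {_ ∷ []}    ([-] _)    []          = []
Chain-⊕ {_ ∷ []}    ([-] _)    ([-] _)     = [-] _
Chain-⊕ {_ ∷ []}    ([-] _)    (_ ∷ _)     = [-] _
Chain-⊕ {_ ∷ _ ∷ _} (_ ∷ _)    []          = []
Chain-⊕ {_ ∷ _ ∷ _} (_ ∷ _)    ([-] _)     = [-] _
Chain-⊕ {p ∷ q ∷ _} (adj ∷ ch) (n≤m ∷ ni)  = AdjOK-+ p q adj n≤m ∷ Chain-⊕ ch ni

AllPositive-⊕ : ∀ {b} π → AllPositive b → AllPositive (b ⊕ π)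
AllPositive-⊕ _       []           = []
AllPositive-⊕ []      (_ ∷ _)      = []
AllPositive-⊕ (m ∷ π) (pos ∷ poss) = ≤-trans pos (m≤m+n _ m) ∷ AllPositive-⊕ π poss

flags-⊕ : ∀ b π → length π ≡ length b → flags (b ⊕ π) ≡ flags b
flags-⊕ []      []      _  = refl
flags-⊕ (p ∷ b) (m ∷ π) eq = cong (overlined p ∷_) (flags-⊕ b π (suc-injective eq))

⊕-cancelˡ : ∀ b {π π′} → length π ≡ length b → length π′ ≡ length b → b ⊕ π ≡ b ⊕ π′ → π ≡ π′
⊕-cancelˡ []      {[]}    {[]}     _  _  _  = refl
⊕-cancelˡ (p ∷ b) {m ∷ π} {m′ ∷ π′} eq eq′ b⊕π≡b⊕π′ with ∷-injective b⊕π≡b⊕π′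
... | head≡ , tail≡ =
  cong₂ _∷_ (+-cancelˡ-≡ (size p) m m′ (cong size head≡))
            (⊕-cancelˡ b (suc-injective eq) (suc-injective eq′) tail≡)

flagLists : ℕ → List (List Bool)
flagLists zero    = [ [] ]
flagLists (suc m) = cartesianProductWith _∷_ (true ∷ false ∷ []) (flagLists m)

∈-flagLists : ∀ os → os ∈ flagLists (length os)
∈-flagLists []       = here refl
∈-flagLists (o ∷ os) = ∈-cartesianProductWith⁺ _∷_ (∈-bools o) (∈-flagLists os)
  where
  ∈-bools : ∀ o → o ∈ true ∷ false ∷ []
  ∈-bools true  = here refl
  ∈-bools false = there (here refl)

module _ (Q : List Part → Set)
         (Q-resp-flags : ∀ {xs ys} → flags xs ≡ flags ys → Q xs → Q ys) where

  OverpartitionsWith : List Part → Set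
  OverpartitionsWith xs = IsOverpartition xs × Q xs

  IsMinimal : List Part → Set
  IsMinimal b = OverpartitionsWith b × b ≡ minimal (flags b)

  minimal-isMinimal : ∀ xs → Q xs → IsMinimal (minimal (flags xs))
  minimal-isMinimal xs q =
    (minimal-isOverpartition (flags xs) , Q-resp-flags (sym (flags-minimal (flags xs))) q) ,
    cong minimal (sym (flags-minimal (flags xs)))

  isMinimal-finite : ∀ m → Σ (List (List Part)) λ L → ∀ b → IsMinimal b → length b ≡ m → b ∈ L
  isMinimal-finite m = map minimal (flagLists m) , λ b (_ , b≡min) len≡m →
    subst (_∈ map minimal (flagLists m)) (sym b≡min)
      (∈-map⁺ minimal (subst (λ k → flags b ∈ flagLists k)
                             (trans (length-map overlined b) len≡m)
                             (∈-flagLists (flags b))))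

  isMinimal-unique : ∀ b b′ π π′ → IsMinimal b → IsMinimal b′ →
                     length π ≡ length b → length π′ ≡ length b′ →
                     b ⊕ π ≡ b′ ⊕ π′ → b ≡ b′ × π ≡ π′
  isMinimal-unique b b′ π π′ (_ , b≡min) (_ , b′≡min) len len′ sums≡ =
    b≡b′ , ⊕-cancelˡ b len (trans len′ (cong length (sym b≡b′)))
                           (trans sums≡ (cong (_⊕ π′) (sym b≡b′)))
    where
    b≡b′ : b ≡ b′
    b≡b′ = begin
      b                         ≡⟨ b≡min ⟩
      minimal (flags b)         ≡⟨ cong minimal (flags-⊕ b π len) ⟨
      minimal (flags (b ⊕ π))   ≡⟨ cong (minimal ∘′ flags) sums≡ ⟩
      minimal (flags (b′ ⊕ π′)) ≡⟨ cong minimal (flags-⊕ b′ π′ len′) ⟩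
      minimal (flags b′)        ≡⟨ b′≡min ⟨
      b′                        ∎
      where open ≡-Reasoning

  overpartitionsWith-separable : Separable OverpartitionsWith
  overpartitionsWith-separable = record
    { Basis       = IsMinimal
    ; basis⊆      = λ _ → proj₁
    ; basisFinite = λ m _ → isMinimal-finite m
    ; decompose   = λ xs (isOP , q) _ →
        minimal (flags xs) , excess xs , minimal-isMinimal xs q ,
        excess-nonIncreasing xs isOP , length-excess xs , sym (minimal⊕excess xs isOP)
    ; unique      = λ b b′ π π′ min min′ _ _ len len′ _ →
        isMinimal-unique b b′ π π′ min min′ len len′
    ; closed      = λ b π (((pos , ch) , q) , _) ni len →
        (AllPositive-⊕ π pos , Chain-⊕ ch ni) ,
        Q-resp-flags (sym (flags-⊕ b π len)) q
    }

NoAdjOverlined-resp-flags : ∀ {xs ys} → flags xs ≡ flags ys → NoAdjOverlined xs → NoAdjOverlined ys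
NoAdjOverlined-resp-flags {[]}         {[]}         _   []        = []
NoAdjOverlined-resp-flags {_ ∷ []}     {_ ∷ []}     _   ([-] _)   = [-] _
NoAdjOverlined-resp-flags {_ ∷ _ ∷ _}  {_ ∷ _ ∷ _}  eq  (no ∷ na) with ∷-injective eq
... | p≡ , rest with ∷-injective rest
...   | q≡ , _ = subst₂ (λ o o′ → o ≡ true → o′ ≡ false) p≡ q≡ no
                 ∷ NoAdjOverlined-resp-flags rest na

theorem5p3 : Separable Lbar
theorem5p3 = overpartitionsWith-separable NoAdjOverlined NoAdjOverlined-resp-flags
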